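{- For every integer $n\ge 0$, there is a bijection between the set of isomorphism classes of split graphs on $n$ vertices and the set of isomorphism classes of bipartite posets on $n$ elements.
   Context: A finite graph is a split graph if its vertex set can be partitioned into a clique and a stable set. A bipartite poset is a finite poset of height at most one, i.e. there are no three elements $x\prec y\prec z$. Posets are considered up to isomorphism. -}

module Defs where

open import Data.Nat.Base using (ℕ)
open import Data.Fin.Base using (Fin)
open import Data.Fin.Permutation using (Permutation′; _⟨$⟩ʳ_; _⟨$⟩ˡ_; inverseʳ; id; flip; _∘ₚ_)
open import Data.Bool.Base using (Bool; true; false)
open import Data.Product.Base using (Σ; ∃; _×_; _,_)
open import Relation.Nullary using (¬_)
open import Relation.Binary.PropositionalEquality using (_≡_; _≢_; refl; sym; trans; cong₂)
open import Relation.Binary.Bundles using (Setoid)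
open import Relation.Binary.Structures using (IsEquivalence)
open import Level using (0ℓ)

record Graph (n : ℕ) : Set where
  field
    adj     : Fin n → Fin n → Bool
    irrefl  : ∀ i → adj i i ≡ false
    symm    : ∀ i j → adj i j ≡ adj j i

IsSplit : ∀ {n} → Graph n → Set
IsSplit {n} G = Σ (Fin n → Bool) λ inClique →
    (∀ i j → inClique i ≡ true → inClique j ≡ true → i ≢ j → Graph.adj G i j ≡ true)
  × (∀ i j → inClique i ≡ false → inClique j ≡ false → Graph.adj G i j ≡ false)

record SplitGraph (n : ℕ) : Set where
  field
    graph   : Graph n
    isSplit : IsSplit graph

_≅G_ : ∀ {n} → SplitGraph n → SplitGraph n → Set
_≅G_ {n} G H = Σ (Permutation′ n) λ σ → ∀ i j →
  Graph.adj (SplitGraph.graph G) i j ≡ Graph.adj (SplitGraph.graph H) (σ ⟨$⟩ʳ i) (σ ⟨$⟩ʳ j)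

record Poset (n : ℕ) : Set where
  field
    leq     : Fin n → Fin n → Bool
    refl′   : ∀ i → leq i i ≡ true
    antisym : ∀ i j → leq i j ≡ true → leq j i ≡ true → i ≡ j
    trans′  : ∀ i j k → leq i j ≡ true → leq j k ≡ true → leq i k ≡ true

_<[_]_ : ∀ {n} → Fin n → Poset n → Fin n → Set
i <[ P ] j = (Poset.leq P i j ≡ true) × (i ≢ j)

HeightAtMostOne : ∀ {n} → Poset n → Set
HeightAtMostOne {n} P = ∀ (x y z : Fin n) → ¬ ((x <[ P ] y) × (y <[ P ] z))

record BipartitePoset (n : ℕ) : Set where
  field
    poset     : Poset n
    heightLe1 : HeightAtMostOne poset

_≅P_ : ∀ {n} → BipartitePoset n → BipartitePoset n → Set
_≅P_ {n} P Q = Σ (Permutation′ n) λ σ → ∀ i j →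
  Poset.leq (BipartitePoset.poset P) i j ≡ Poset.leq (BipartitePoset.poset Q) (σ ⟨$⟩ʳ i) (σ ⟨$⟩ʳ j)

-- Isomorphism is an equivalence; the resulting setoids model the sets
-- of isomorphism classes.

module _ {n : ℕ} {A : Set} (R : A → Fin n → Fin n → Bool) where
  private
    _≃_ : A → A → Set
    x ≃ y = Σ (Permutation′ n) λ σ → ∀ i j → R x i j ≡ R y (σ ⟨$⟩ʳ i) (σ ⟨$⟩ʳ j)

  ≃-isEquivalence : IsEquivalence _≃_
  ≃-isEquivalence = record
    { refl  = id , λ i j → refl
    ; sym   = λ { (σ , p) → flip σ , λ i j →
                 sym (trans (p (σ ⟨$⟩ˡ i) (σ ⟨$⟩ˡ j))
                            (cong₂ (R _) (inverseʳ σ) (inverseʳ σ))) }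
    ; trans = λ { (σ , p) (τ , q) → σ ∘ₚ τ , λ i j →
                 trans (p i j) (q (σ ⟨$⟩ʳ i) (σ ⟨$⟩ʳ j)) }
    }

SplitGraphSetoid : ℕ → Setoid 0ℓ 0ℓ
SplitGraphSetoid n = record
  { Carrier       = SplitGraph n
  ; _≈_           = _≅G_
  ; isEquivalence = ≃-isEquivalence (λ G → Graph.adj (SplitGraph.graph G))
  }

BipartitePosetSetoid : ℕ → Setoid 0ℓ 0ℓ
BipartitePosetSetoid n = record
  { Carrier       = BipartitePoset n
  ; _≈_           = _≅P_
  ; isEquivalence = ≃-isEquivalence (λ P → Poset.leq (BipartitePoset.poset P))
  }

module Submission where

-- A side assignment c : Fin n → Bool (true = clique side) of a graph induces the
-- partition order, in which i < j when i is on the stable side, j on the clique side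
-- and ij is an edge; it has height at most one.  Conversely a bipartite poset yields
-- the graph joining elements that are comparable or both upper (have something
-- strictly below them); the upper elements split it.  Since a split graph may have
-- several split partitions, we use maximal splittings, in which every clique vertex
-- has a stable neighbour, and show: every splitting can be made maximal by moving
-- one vertex (maximise); two maximal splittings differ by an automorphism swapping
-- two twins (maximal-splittings-related), so their partition orders are isomorphic;
-- and the two constructions are mutually inverse on maximal splittings
-- (partitionLeq-upper, posetGraph-partition).

open import Defs
open import Data.Nat.Base using (ℕ)
open import Data.Bool.Base using (Bool; true; false)
open import Data.Bool.Properties using (¬-not) renaming (_≟_ to _≟ᵇ_)
open import Data.Fin.Base using (Fin)
open import Data.Fin.Properties using (_≟_; any?)
open import Data.Fin.Permutation using (Permutation′; _⟨$⟩ʳ_; _⟨$⟩ˡ_; inverseʳ; id; transpose)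
open import Data.Product.Base using (Σ; ∃; _×_; _,_; proj₁; proj₂)
open import Data.Sum.Base using (_⊎_; inj₁; inj₂)
open import Data.Empty using (⊥; ⊥-elim)
open import Function.Base using (_∘_)
open import Function.Bundles using (Inverse; Injection; mk⇔)
open import Function.Properties.Inverse using (↔⇒↣)
open import Relation.Nullary using (¬_; Dec; yes; no; does; contradiction)
open import Relation.Nullary.Decidable using (dec-true; dec-false; does-⇔; _×-dec_; _⊎-dec_; ¬?; decidable-stable)
open import Relation.Binary.PropositionalEquality using (_≡_; _≢_; refl; sym; trans; cong)
open import Relation.Binary.Bundles using (Setoid)

not-both : ∀ {b} → b ≡ true → b ≡ false → ⊥
not-both refl ()

does-sound : ∀ {A : Set} (a? : Dec A) → does a? ≡ true → A
does-sound (yes a) _ = a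
does-sound (no _) ()

does-refutes : ∀ {A : Set} (a? : Dec A) → does a? ≡ false → ¬ A
does-refutes a? p a = not-both (dec-true a? a) p

does-unique : ∀ {A : Set} (a? : Dec A) (b : Bool) → (A → b ≡ true) → (b ≡ true → A) → does a? ≡ b
does-unique a? true  _        sound = dec-true a? (sound refl)
does-unique a? false complete _     = dec-false a? (λ a → not-both (complete a) refl)

module _ {n : ℕ} where

  permutation-injective : (σ : Permutation′ n) {i j : Fin n} → σ ⟨$⟩ʳ i ≡ σ ⟨$⟩ʳ j → i ≡ j
  permutation-injective σ = Injection.injective (↔⇒↣ σ)

  data Swap (k s : Fin n) : Fin n → Fin n → Set where
    left  : Swap k s k s
    right : Swap k s s k
    fixed : ∀ {x} → x ≢ k → x ≢ s → Swap k s x x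

  transpose-swap : (k s x : Fin n) → Swap k s x (transpose k s ⟨$⟩ʳ x)
  transpose-swap k s x with x ≟ k
  ... | yes refl = left
  ... | no x≢k with x ≟ s
  ...   | yes refl = right
  ...   | no x≢s = fixed x≢k x≢s

  module _ (G : Graph n) where
    open Graph G

    IsClique IsStable : (Fin n → Bool) → Set
    IsClique c = ∀ i j → c i ≡ true → c j ≡ true → i ≢ j → adj i j ≡ true
    IsStable c = ∀ i j → c i ≡ false → c j ≡ false → adj i j ≡ false

    HasStableNeighbour : (Fin n → Bool) → Fin n → Set
    HasStableNeighbour c k = ∃ λ s → c s ≡ false × adj k s ≡ true

    hasStableNeighbour? : ∀ c k → Dec (HasStableNeighbour c k)
    hasStableNeighbour? c k = any? (λ s → (c s ≟ᵇ false) ×-dec (adj k s ≟ᵇ true))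

    -- A split partition whose stable side is a maximal stable set: no clique vertex
    -- can be moved to the stable side.
    record MaximalSplitting : Set where
      field
        side    : Fin n → Bool
        clique  : IsClique side
        stable  : IsStable side
        maximal : ∀ k → side k ≡ true → HasStableNeighbour side k

    Below : (Fin n → Bool) → Fin n → Fin n → Set
    Below c i j = c i ≡ false × c j ≡ true × adj i j ≡ true

    below? : ∀ c i j → Dec (Below c i j)
    below? c i j = (c i ≟ᵇ false) ×-dec (c j ≟ᵇ true) ×-dec (adj i j ≟ᵇ true)

    partitionLeq? : ∀ c i j → Dec (i ≡ j ⊎ Below c i j)
    partitionLeq? c i j = (i ≟ j) ⊎-dec below? c i j

    partitionLeq : (Fin n → Bool) → Fin n → Fin n → Bool
    partitionLeq c i j = does (partitionLeq? c i j)

    below-of-strict : ∀ c {i j} → partitionLeq c i j ≡ true → i ≢ j → Below c i j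
    below-of-strict c {i} {j} p i≢j with does-sound (partitionLeq? c i j) p
    ... | inj₁ i≡j = contradiction i≡j i≢j
    ... | inj₂ b   = b

    -- Every side assignment gives a poset of height at most one: the element in the
    -- middle of a chain would have to lie on both sides.
    partitionPoset : (Fin n → Bool) → BipartitePoset n
    partitionPoset c = record
      { poset = record
        { leq     = partitionLeq c
        ; refl′   = λ i → dec-true (partitionLeq? c i i) (inj₁ refl)
        ; antisym = antisym
        ; trans′  = trans′
        }
      ; heightLe1 = λ x y z ((p , x≢y) , (q , y≢z)) →
          not-both (proj₁ (proj₂ (below-of-strict c p x≢y))) (proj₁ (below-of-strict c q y≢z))
      }
      where
      antisym : ∀ i j → partitionLeq c i j ≡ true → partitionLeq c j i ≡ true → i ≡ j
      antisym i j p q with does-sound (partitionLeq? c i j) p | does-sound (partitionLeq? c j i) q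
      ... | inj₁ i≡j             | _                    = i≡j
      ... | inj₂ _               | inj₁ j≡i             = sym j≡i
      ... | inj₂ (_ , cj , _)    | inj₂ (cj′ , _ , _)   = ⊥-elim (not-both cj cj′)

      trans′ : ∀ i j k → partitionLeq c i j ≡ true → partitionLeq c j k ≡ true → partitionLeq c i k ≡ true
      trans′ i j k p q with does-sound (partitionLeq? c i j) p | does-sound (partitionLeq? c j k) q
      ... | inj₁ refl            | _                    = q
      ... | inj₂ _               | inj₁ refl            = p
      ... | inj₂ (_ , cj , _)    | inj₂ (cj′ , _ , _)   = ⊥-elim (not-both cj cj′)

    demote : (Fin n → Bool) → Fin n → Fin n → Bool
    demote c z v with v ≟ z
    ... | yes _ = false
    ... | no _  = c v

    demote-cases : ∀ c z v → (v ≡ z × demote c z v ≡ false) ⊎ (v ≢ z × demote c z v ≡ c v)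
    demote-cases c z v with v ≟ z
    ... | yes v≡z = inj₁ (v≡z , refl)
    ... | no v≢z  = inj₂ (v≢z , refl)

    -- If some clique vertex z has no
    -- stable neighbour, move it to the stable side; afterwards z is a stable
    -- neighbour of every remaining clique vertex, so one move suffices.
    maximise : IsSplit G → MaximalSplitting
    maximise (c , cl , st) with any? (λ k → (c k ≟ᵇ true) ×-dec ¬? (hasStableNeighbour? c k))
    ... | no none = record
      { side    = c
      ; clique  = cl
      ; stable  = st
      ; maximal = λ k ck → decidable-stable (hasStableNeighbour? c k) (λ ¬h → none (k , ck , ¬h))
      }
    ... | yes (z , cz , lonely) = record
      { side = c′ ; clique = clique′ ; stable = stable′ ; maximal = maximal′ }
      where
      c′ : Fin n → Bool
      c′ = demote c z

      isolated : ∀ j → c j ≡ false → adj z j ≡ false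
      isolated j cj = ¬-not (λ a → lonely (j , cj , a))

      clique′ : IsClique c′
      clique′ i j p q i≢j with demote-cases c z i | demote-cases c z j
      ... | inj₁ (_ , fi)  | _              = ⊥-elim (not-both p fi)
      ... | inj₂ _         | inj₁ (_ , fj)  = ⊥-elim (not-both q fj)
      ... | inj₂ (_ , ei)  | inj₂ (_ , ej)  = cl i j (trans (sym ei) p) (trans (sym ej) q) i≢j

      stable′ : IsStable c′
      stable′ i j p q with demote-cases c z i | demote-cases c z j
      ... | inj₁ (refl , _) | inj₁ (refl , _) = irrefl z
      ... | inj₁ (refl , _) | inj₂ (_ , ej)   = isolated j (trans (sym ej) q)
      ... | inj₂ (_ , ei)   | inj₁ (refl , _) = trans (symm i z) (isolated i (trans (sym ei) p))
      ... | inj₂ (_ , ei)   | inj₂ (_ , ej)   = st i j (trans (sym ei) p) (trans (sym ej) q)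

      z-demoted : c′ z ≡ false
      z-demoted with demote-cases c z z
      ... | inj₁ (_ , fz)   = fz
      ... | inj₂ (z≢z , _)  = contradiction refl z≢z

      maximal′ : ∀ k → c′ k ≡ true → HasStableNeighbour c′ k
      maximal′ k p with demote-cases c z k
      ... | inj₁ (_ , fk)    = ⊥-elim (not-both p fk)
      ... | inj₂ (k≢z , ek)  = z , z-demoted , cl k z (trans (sym ek) p) cz k≢z

    swap-twins : ∀ {k s} → (∀ x → x ≢ k → x ≢ s → adj x k ≡ adj x s) →
                 ∀ {i i′ j j′} → Swap k s i i′ → Swap k s j j′ → adj i j ≡ adj i′ j′
    swap-twins {k} {s} twin = go
      where
      go : ∀ {i i′ j j′} → Swap k s i i′ → Swap k s j j′ → adj i j ≡ adj i′ j′
      go left              left              = trans (irrefl k) (sym (irrefl s))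
      go left              right             = symm k s
      go left              (fixed x≢k x≢s)   = trans (symm k _) (trans (twin _ x≢k x≢s) (symm _ s))
      go right             left              = symm s k
      go right             right             = trans (irrefl s) (sym (irrefl k))
      go right             (fixed x≢k x≢s)   = trans (symm s _) (trans (sym (twin _ x≢k x≢s)) (symm _ k))
      go (fixed x≢k x≢s)   left              = twin _ x≢k x≢s
      go (fixed x≢k x≢s)   right             = sym (twin _ x≢k x≢s)
      go (fixed _ _)       (fixed _ _)       = refl

    module _ (c d : MaximalSplitting) where
      private
        module C = MaximalSplitting c
        module D = MaximalSplitting d

      Demoted Promoted : Fin n → Set
      Demoted  x = C.side x ≡ true  × D.side x ≡ false
      Promoted x = C.side x ≡ false × D.side x ≡ true

      -- Two demoted vertices would be adjacent (clique in c) and non-adjacent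
      -- (stable in d); dually for promoted ones.
      demoted-unique : ∀ {k x} → Demoted k → Demoted x → x ≢ k → ⊥
      demoted-unique (ck , dk) (cx , dx) x≢k = not-both (C.clique _ _ cx ck x≢k) (D.stable _ _ dx dk)

      promoted-unique : ∀ {s x} → Promoted s → Promoted x → x ≢ s → ⊥
      promoted-unique (cs , ds) (cx , dx) x≢s = not-both (D.clique _ _ dx ds x≢s) (C.stable _ _ cx cs)

      keeps-side : ∀ x → ¬ Demoted x → ¬ Promoted x → D.side x ≡ C.side x
      keeps-side x ¬demoted ¬promoted with C.side x | D.side x
      ... | true  | true  = refl
      ... | false | false = refl
      ... | true  | false = contradiction (refl , refl) ¬demoted
      ... | false | true  = contradiction (refl , refl) ¬promoted

      -- A promoted vertex x has a d-stable neighbour, which is c-stable unless it is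
      -- demoted; so without demoted vertices there are no promoted ones either.
      no-promoted : (∀ k → ¬ Demoted k) → ∀ x → ¬ Promoted x
      no-promoted none x (cx , dx) with D.maximal x dx
      ... | s , ds , a with C.side s in cs
      ...   | true  = none s (cs , ds)
      ...   | false = not-both a (C.stable x s cx cs)

      promoted-partner : ∀ {k s} → Demoted k → C.side s ≡ false → adj k s ≡ true → Promoted s
      promoted-partner {k} {s} (_ , dk) cs a with D.side s in ds
      ... | true  = cs , refl
      ... | false = ⊥-elim (not-both a (D.stable k s dk ds))

      -- A demoted k and a promoted s are twins: any other vertex on the clique side
      -- is adjacent to both, any other on the stable side to neither.
      module _ {k s : Fin n} (demoted : Demoted k) (promoted : Promoted s) where
        others-keep-side : ∀ {x} → x ≢ k → x ≢ s → D.side x ≡ C.side x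
        others-keep-side {x} x≢k x≢s =
          keeps-side x (λ dx → demoted-unique demoted dx x≢k) (λ px → promoted-unique promoted px x≢s)

        twins : ∀ x → x ≢ k → x ≢ s → adj x k ≡ adj x s
        twins x x≢k x≢s with C.side x in cx
        ... | true  = trans (C.clique x k cx (proj₁ demoted) x≢k)
                            (sym (D.clique x s (trans (others-keep-side x≢k x≢s) cx) (proj₂ promoted) x≢s))
        ... | false = trans (D.stable x k (trans (others-keep-side x≢k x≢s) cx) (proj₂ demoted))
                            (sym (C.stable x s cx (proj₁ promoted)))

        swap-sides : ∀ {x x′} → Swap k s x x′ → D.side x′ ≡ C.side x
        swap-sides left              = trans (proj₂ promoted) (sym (proj₁ demoted))
        swap-sides right             = trans (proj₂ demoted) (sym (proj₁ promoted))
        swap-sides (fixed x≢k x≢s)   = others-keep-side x≢k x≢s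

      -- Any two maximal splittings are related by an automorphism of G: the identity
      -- if nothing is demoted, otherwise the transposition of the demoted vertex with
      -- its promoted partner.
      maximal-splittings-related :
        Σ (Permutation′ n) λ τ → (∀ i j → adj i j ≡ adj (τ ⟨$⟩ʳ i) (τ ⟨$⟩ʳ j))
                               × (∀ x → D.side (τ ⟨$⟩ʳ x) ≡ C.side x)
      maximal-splittings-related with any? (λ k → (C.side k ≟ᵇ true) ×-dec (D.side k ≟ᵇ false))
      ... | no none =
        id , (λ _ _ → refl) ,
        λ x → keeps-side x (λ dx → none (x , dx)) (no-promoted (λ k dk → none (k , dk)) x)
      ... | yes (k , demoted) with C.maximal k (proj₁ demoted)
      ...   | s , cs , a =
        transpose k s ,
        (λ i j → swap-twins (twins demoted promoted) (transpose-swap k s i) (transpose-swap k s j)) ,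
        (λ x → swap-sides demoted promoted (transpose-swap k s x))
        where
        promoted : Promoted s
        promoted = promoted-partner demoted cs a

  open MaximalSplitting using (side)

  partitionPoset-iso : (G H : Graph n) (σ : Permutation′ n) →
    (∀ i j → Graph.adj G i j ≡ Graph.adj H (σ ⟨$⟩ʳ i) (σ ⟨$⟩ʳ j)) →
    (c d : Fin n → Bool) → (∀ x → d (σ ⟨$⟩ʳ x) ≡ c x) →
    partitionPoset G c ≅P partitionPoset H d
  partitionPoset-iso G H σ iso c d sides =
    σ , λ i j → does-⇔ (mk⇔ (forward i j) (backward i j))
                       (partitionLeq? G c i j) (partitionLeq? H d (σ ⟨$⟩ʳ i) (σ ⟨$⟩ʳ j))
    where
    forward : ∀ i j → i ≡ j ⊎ Below G c i j → σ ⟨$⟩ʳ i ≡ σ ⟨$⟩ʳ j ⊎ Below H d (σ ⟨$⟩ʳ i) (σ ⟨$⟩ʳ j)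
    forward i j (inj₁ i≡j)           = inj₁ (cong (σ ⟨$⟩ʳ_) i≡j)
    forward i j (inj₂ (ci , cj , a)) = inj₂ (trans (sides i) ci , trans (sides j) cj , trans (sym (iso i j)) a)

    backward : ∀ i j → σ ⟨$⟩ʳ i ≡ σ ⟨$⟩ʳ j ⊎ Below H d (σ ⟨$⟩ʳ i) (σ ⟨$⟩ʳ j) → i ≡ j ⊎ Below G c i j
    backward i j (inj₁ σi≡σj)         = inj₁ (permutation-injective σ σi≡σj)
    backward i j (inj₂ (di , dj , a)) = inj₂ (trans (sym (sides i)) di , trans (sym (sides j)) dj , trans (iso i j) a)

  pullback : (G H : Graph n) (σ : Permutation′ n) →
    (∀ i j → Graph.adj G i j ≡ Graph.adj H (σ ⟨$⟩ʳ i) (σ ⟨$⟩ʳ j)) →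
    MaximalSplitting H → MaximalSplitting G
  pullback G H σ iso d = record
    { side    = λ x → D.side (σ ⟨$⟩ʳ x)
    ; clique  = λ i j p q i≢j → trans (iso i j) (D.clique _ _ p q (i≢j ∘ permutation-injective σ))
    ; stable  = λ i j p q → trans (iso i j) (D.stable _ _ p q)
    ; maximal = maximal
    }
    where
    module D = MaximalSplitting d

    maximal : ∀ k → D.side (σ ⟨$⟩ʳ k) ≡ true → HasStableNeighbour G (λ x → D.side (σ ⟨$⟩ʳ x)) k
    maximal k p with D.maximal (σ ⟨$⟩ʳ k) p
    ... | s , ds , a = σ ⟨$⟩ˡ s , trans (cong D.side (inverseʳ σ)) ds ,
                       trans (iso k _) (trans (cong (Graph.adj H (σ ⟨$⟩ʳ k)) (inverseʳ σ)) a)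

  maximal-splittings-isomorphic : (G : Graph n) (c d : MaximalSplitting G) →
    partitionPoset G (side c) ≅P partitionPoset G (side d)
  maximal-splittings-isomorphic G c d with maximal-splittings-related G c d
  ... | τ , automorphism , sides = partitionPoset-iso G G τ automorphism (side c) (side d) sides

  module _ (P : BipartitePoset n) where
    open BipartitePoset P using (poset; heightLe1)
    open Poset poset

    Upper : Fin n → Set
    Upper i = ∃ λ j → j <[ poset ] i

    upper? : ∀ i → Dec (Upper i)
    upper? i = any? (λ j → (leq j i ≟ᵇ true) ×-dec ¬? (j ≟ i))

    upper : Fin n → Bool
    upper i = does (upper? i)

    below-not-upper : ∀ {j i} → j <[ poset ] i → upper j ≡ false
    below-not-upper j<i = dec-false (upper? _) (λ (m , m<j) → heightLe1 m _ _ (m<j , j<i))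

    Adjacent : Fin n → Fin n → Set
    Adjacent i j = i ≢ j × ((Upper i × Upper j) ⊎ (leq i j ≡ true ⊎ leq j i ≡ true))

    adjacent? : ∀ i j → Dec (Adjacent i j)
    adjacent? i j = ¬? (i ≟ j) ×-dec ((upper? i ×-dec upper? j) ⊎-dec ((leq i j ≟ᵇ true) ⊎-dec (leq j i ≟ᵇ true)))

    posetGraph : Graph n
    posetGraph = record
      { adj    = λ i j → does (adjacent? i j)
      ; irrefl = λ i → dec-false (adjacent? i i) (λ (i≢i , _) → i≢i refl)
      ; symm   = λ i j → does-⇔ (mk⇔ flip flip) (adjacent? i j) (adjacent? j i)
      }
      where
      flip : ∀ {i j} → Adjacent i j → Adjacent j i
      flip (i≢j , inj₁ (ui , uj))  = i≢j ∘ sym , inj₁ (uj , ui)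
      flip (i≢j , inj₂ (inj₁ lij)) = i≢j ∘ sym , inj₂ (inj₂ lij)
      flip (i≢j , inj₂ (inj₂ lji)) = i≢j ∘ sym , inj₂ (inj₁ lji)

    -- The upper elements form a clique, and the others a stable set since an element
    -- strictly above another is upper.  The splitting is maximal: an upper element is
    -- adjacent to the non-upper element below it.
    upperSplitting : MaximalSplitting posetGraph
    upperSplitting = record
      { side    = upper
      ; clique  = λ i j p q i≢j → dec-true (adjacent? i j) (i≢j , inj₁ (does-sound (upper? i) p , does-sound (upper? j) q))
      ; stable  = stable
      ; maximal = maximal
      }
      where
      stable : IsStable posetGraph upper
      stable i j p q = dec-false (adjacent? i j) λ where
        (_   , inj₁ (ui , _))     → does-refutes (upper? i) p ui
        (i≢j , inj₂ (inj₁ lij))   → does-refutes (upper? j) q (i , lij , i≢j)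
        (i≢j , inj₂ (inj₂ lji))   → does-refutes (upper? i) p (j , lji , i≢j ∘ sym)

      maximal : ∀ k → upper k ≡ true → HasStableNeighbour posetGraph upper k
      maximal k p with does-sound (upper? k) p
      ... | j , j<k@(ljk , j≢k) = j , below-not-upper j<k , dec-true (adjacent? k j) (j≢k ∘ sym , inj₂ (inj₂ ljk))

    splitGraph : SplitGraph n
    splitGraph = record
      { graph   = posetGraph
      ; isSplit = upper , MaximalSplitting.clique upperSplitting , MaximalSplitting.stable upperSplitting
      }

    partitionLeq-upper : ∀ i j → partitionLeq posetGraph upper i j ≡ leq i j
    partitionLeq-upper i j = does-unique (partitionLeq? posetGraph upper i j) (leq i j) sound complete
      where
      sound : i ≡ j ⊎ Below posetGraph upper i j → leq i j ≡ true
      sound (inj₁ refl) = refl′ i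
      sound (inj₂ (ui , _ , a)) with does-sound (adjacent? i j) a
      ... | _   , inj₁ (Ui , _)    = ⊥-elim (does-refutes (upper? i) ui Ui)
      ... | _   , inj₂ (inj₁ lij)  = lij
      ... | i≢j , inj₂ (inj₂ lji)  = ⊥-elim (does-refutes (upper? i) ui (j , lji , i≢j ∘ sym))

      complete : leq i j ≡ true → i ≡ j ⊎ Below posetGraph upper i j
      complete lij = by-equality (i ≟ j)
        where
        by-equality : Dec (i ≡ j) → i ≡ j ⊎ Below posetGraph upper i j
        by-equality (yes i≡j) = inj₁ i≡j
        by-equality (no i≢j)  = inj₂ ( below-not-upper (lij , i≢j)
                                     , dec-true (upper? j) (i , lij , i≢j)
                                     , dec-true (adjacent? i j) (i≢j , inj₂ (inj₁ lij)) )

  posetGraph-iso : (P Q : BipartitePoset n) → P ≅P Q → splitGraph P ≅G splitGraph Q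
  posetGraph-iso P Q (σ , iso) =
    σ , λ i j → does-⇔ (mk⇔ (forward i j) (backward i j)) (adjacent? P i j) (adjacent? Q (σ ⟨$⟩ʳ i) (σ ⟨$⟩ʳ j))
    where
    open Poset (BipartitePoset.poset Q) using () renaming (leq to leqQ)

    upper-forward : ∀ {i} → Upper P i → Upper Q (σ ⟨$⟩ʳ i)
    upper-forward {i} (j , lji , j≢i) = σ ⟨$⟩ʳ j , trans (sym (iso j i)) lji , j≢i ∘ permutation-injective σ

    upper-backward : ∀ {i} → Upper Q (σ ⟨$⟩ʳ i) → Upper P i
    upper-backward {i} (j , lji , j≢σi) =
      σ ⟨$⟩ˡ j , trans (iso _ i) (trans (cong (λ x → leqQ x (σ ⟨$⟩ʳ i)) (inverseʳ σ)) lji) ,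
      λ σ⁻¹j≡i → j≢σi (trans (sym (inverseʳ σ)) (cong (σ ⟨$⟩ʳ_) σ⁻¹j≡i))

    forward : ∀ i j → Adjacent P i j → Adjacent Q (σ ⟨$⟩ʳ i) (σ ⟨$⟩ʳ j)
    forward i j (i≢j , inj₁ (ui , uj))  = i≢j ∘ permutation-injective σ , inj₁ (upper-forward ui , upper-forward uj)
    forward i j (i≢j , inj₂ (inj₁ lij)) = i≢j ∘ permutation-injective σ , inj₂ (inj₁ (trans (sym (iso i j)) lij))
    forward i j (i≢j , inj₂ (inj₂ lji)) = i≢j ∘ permutation-injective σ , inj₂ (inj₂ (trans (sym (iso j i)) lji))

    backward : ∀ i j → Adjacent Q (σ ⟨$⟩ʳ i) (σ ⟨$⟩ʳ j) → Adjacent P i j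
    backward i j (σi≢σj , inj₁ (ui , uj))  = σi≢σj ∘ cong (σ ⟨$⟩ʳ_) , inj₁ (upper-backward ui , upper-backward uj)
    backward i j (σi≢σj , inj₂ (inj₁ lij)) = σi≢σj ∘ cong (σ ⟨$⟩ʳ_) , inj₂ (inj₁ (trans (iso i j) lij))
    backward i j (σi≢σj , inj₂ (inj₂ lji)) = σi≢σj ∘ cong (σ ⟨$⟩ʳ_) , inj₂ (inj₂ (trans (iso j i) lji))

  module _ (G : Graph n) (c : MaximalSplitting G) where
    open Graph G
    open MaximalSplitting c using (clique; stable; maximal)

    private
      Q : BipartitePoset n
      Q = partitionPoset G (side c)

    upper⇒clique : ∀ {i} → Upper Q i → side c i ≡ true
    upper⇒clique (j , lji , j≢i) = proj₁ (proj₂ (below-of-strict G (side c) lji j≢i))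

    clique⇒upper : ∀ {i} → side c i ≡ true → Upper Q i
    clique⇒upper {i} ci with maximal i ci
    ... | s , cs , a = s , dec-true (partitionLeq? G (side c) s i) (inj₂ (cs , ci , trans (symm s i) a)) ,
                       λ { refl → not-both ci cs }

    posetGraph-partition : ∀ i j → Graph.adj (posetGraph Q) i j ≡ adj i j
    posetGraph-partition i j = does-unique (adjacent? Q i j) (adj i j) sound complete
      where
      sound : Adjacent Q i j → adj i j ≡ true
      sound (i≢j , inj₁ (ui , uj))  = clique i j (upper⇒clique ui) (upper⇒clique uj) i≢j
      sound (i≢j , inj₂ (inj₁ lij)) = proj₂ (proj₂ (below-of-strict G (side c) lij i≢j))
      sound (i≢j , inj₂ (inj₂ lji)) = trans (symm i j) (proj₂ (proj₂ (below-of-strict G (side c) lji (i≢j ∘ sym))))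

      comparable : ∀ {bi bj} → side c i ≡ bi → side c j ≡ bj → adj i j ≡ true →
                   (Upper Q i × Upper Q j) ⊎ (partitionLeq G (side c) i j ≡ true ⊎ partitionLeq G (side c) j i ≡ true)
      comparable {true}  {true}  ci cj a = inj₁ (clique⇒upper ci , clique⇒upper cj)
      comparable {false} {true}  ci cj a = inj₂ (inj₁ (dec-true (partitionLeq? G (side c) i j) (inj₂ (ci , cj , a))))
      comparable {true}  {false} ci cj a = inj₂ (inj₂ (dec-true (partitionLeq? G (side c) j i) (inj₂ (cj , ci , trans (symm j i) a))))
      comparable {false} {false} ci cj a = ⊥-elim (not-both a (stable i j ci cj))

      complete : adj i j ≡ true → Adjacent Q i j
      complete a = (λ { refl → not-both a (irrefl i) }) , comparable refl refl a

  canonicalSplitting : (S : SplitGraph n) → MaximalSplitting (SplitGraph.graph S)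
  canonicalSplitting S = maximise (SplitGraph.graph S) (SplitGraph.isSplit S)

  splitPoset : SplitGraph n → BipartitePoset n
  splitPoset S = partitionPoset (SplitGraph.graph S) (side (canonicalSplitting S))

  -- Transitivity of isomorphism, with the endpoints made explicit since they cannot
  -- be inferred from the proofs.
  ≅P-trans : {P Q R : BipartitePoset n} → P ≅P Q → Q ≅P R → P ≅P R
  ≅P-trans {P} {Q} {R} = Setoid.trans (BipartitePosetSetoid n) {P} {Q} {R}

  ≅G-trans : {S T U : SplitGraph n} → S ≅G T → T ≅G U → S ≅G U
  ≅G-trans {S} {T} {U} = Setoid.trans (SplitGraphSetoid n) {S} {T} {U}

  splitPoset-iso : (S T : SplitGraph n) → S ≅G T → splitPoset S ≅P splitPoset T
  splitPoset-iso S T (σ , iso) =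
    ≅P-trans {splitPoset S} {partitionPoset G (side d′)} {splitPoset T}
      (maximal-splittings-isomorphic G (canonicalSplitting S) d′)
      (partitionPoset-iso G H σ iso (side d′) (side (canonicalSplitting T)) (λ _ → refl))
    where
    G = SplitGraph.graph S
    H = SplitGraph.graph T
    d′ : MaximalSplitting G
    d′ = pullback G H σ iso (canonicalSplitting T)

  splitPoset-splitGraph : (P : BipartitePoset n) → splitPoset (splitGraph P) ≅P P
  splitPoset-splitGraph P =
    ≅P-trans {splitPoset (splitGraph P)} {partitionPoset (posetGraph P) (upper P)} {P}
      (maximal-splittings-isomorphic (posetGraph P) (canonicalSplitting (splitGraph P)) (upperSplitting P))
      (id , partitionLeq-upper P)

  splitGraph-splitPoset : (S : SplitGraph n) → splitGraph (splitPoset S) ≅G S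
  splitGraph-splitPoset S = id , posetGraph-partition (SplitGraph.graph S) (canonicalSplitting S)

theorem4p1 : (n : ℕ) → Inverse (SplitGraphSetoid n) (BipartitePosetSetoid n)
theorem4p1 n = record
  { to        = splitPoset
  ; from      = splitGraph
  ; to-cong   = λ {S} {T} → splitPoset-iso S T
  ; from-cong = λ {P} {Q} → posetGraph-iso P Q
  ; inverse   = (λ {P} {S} S≅graphP →
                   ≅P-trans {P = splitPoset S} {Q = splitPoset (splitGraph P)} {R = P}
                     (splitPoset-iso S (splitGraph P) S≅graphP) (splitPoset-splitGraph P))
              , (λ {S} {P} P≅posetS →
                   ≅G-trans {S = splitGraph P} {T = splitGraph (splitPoset S)} {U = S}
                     (posetGraph-iso P (splitPoset S) P≅posetS) (splitGraph-splitPoset S))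
  }
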